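{- For all integers $r \ge 3$, \[ 12\left(\frac{r-1}{r}\right)^3 \le \mathrm{OPT}_r(P_3). \]
   Context: All graphs are finite and simple. $P_3$ is the path with 3 edges (4 vertices). For graphs $T,G$, $\nu(T,G)$ is the number of (not necessarily induced) subgraphs of $G$ isomorphic to $T$, and $d(T,G) = \nu(T,G)\binom{|V(G)|}{|V(T)|}^{ -1}$. A graph is $K_{r+1}$-free if it contains no subgraph isomorphic to the complete graph $K_{r+1}$. Letting $\mathcal{F}_{n,r}$ be the family of $K_{r+1}$-free graphs on $n$ vertices, $\mathrm{OPT}_r(P_3) = \lim_{n\to\infty} \max_{G \in \mathcal{F}_{n,r}} d(P_3,G)$. -}

module Defs where

open import Data.Bool using (Bool; true; false; _∧_; not; if_then_else_)
open import Data.Nat using (ℕ; zero; suc; _+_; _*_; _∸_; _^_; _≤_; _<ᵇ_)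
open import Data.Nat.Combinatorics using (_C_)
open import Data.Fin using (Fin; toℕ; _≟_)
open import Data.List using (List; map; allFin)
open import Data.Nat.ListAction using (sum)
open import Data.Product using (Σ; ∃; ∃-syntax; _×_)
open import Relation.Nullary using (¬_; does)
open import Relation.Binary.PropositionalEquality using (_≡_; _≢_)
open import Function.Definitions using (Injective)

record Graph (n : ℕ) : Set where
  field
    adj   : Fin n → Fin n → Bool
    sym   : ∀ i j → adj i j ≡ adj j i
    irrefl : ∀ i → adj i i ≡ false
open Graph public

ContainsK : ∀ {n} → ℕ → Graph n → Set
ContainsK {n} m G =
  Σ (Fin m → Fin n) λ f →
    Injective _≡_ _≡_ f × (∀ i j → i ≢ j → adj G (f i) (f j) ≡ true)

KFree : ∀ {n} → ℕ → Graph n → Set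
KFree r G = ¬ ContainsK (suc r) G

countFin : (n : ℕ) → (Fin n → Bool) → ℕ
countFin n p = sum (map (λ i → if p i then 1 else 0) (allFin n))

neq : ∀ {n} → Fin n → Fin n → Bool
neq a b = not (does (a ≟ b))

-- Each P_3-subgraph of G corresponds to exactly two vertex sequences
-- (a,b,c,d) and (d,c,b,a); we pick the canonical one with a < d.
isP3 : ∀ {n} → Graph n → Fin n → Fin n → Fin n → Fin n → Bool
isP3 G a b c d =
  neq a b ∧ neq a c ∧ neq a d ∧ neq b c ∧ neq b d ∧ neq c d
  ∧ adj G a b ∧ adj G b c ∧ adj G c d ∧ (toℕ a <ᵇ toℕ d)

ΣFin : (n : ℕ) → (Fin n → ℕ) → ℕ
ΣFin n f = sum (map f (allFin n))

νP3 : ∀ {n} → Graph n → ℕ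
νP3 {n} G =
  ΣFin n λ a → ΣFin n λ b → ΣFin n λ c →
    countFin n λ d → isP3 G a b c d

-- "d(P_3,G) ≥ 12((r-1)/r)^3 - 1/k", cleared of denominators
-- (d(P_3,G) = ν(P_3,G) / C(n,4)):
--   12 (r-1)^3 k C(n,4) ≤ ν(P_3,G) r^3 k + r^3 C(n,4)
DensityBound : ∀ {n} → ℕ → ℕ → Graph n → Set
DensityBound {n} r k G =
  12 * (r ∸ 1) ^ 3 * k * (n C 4) ≤ νP3 G * r ^ 3 * k + r ^ 3 * (n C 4)

{-# OPTIONS --safe #-}
-- The complete r-partite graph G on n vertices whose parts have at most ⌊n/r⌋ + 1 vertices is
-- K_{r+1}-free (pigeonhole) and has minimum degree δ ≥ n - ⌊n/r⌋ - 1 ≈ (r-1)n/r. Growing a path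
-- a b c d greedily leaves at least δ, δ - 1 and δ - 2 choices for b, c and d, and every copy of P₃
-- arises from exactly two such sequences, so 2ν(P₃,G) ≥ n δ(δ-1)(δ-2) ≈ 24 ((r-1)/r)³ C(n,4).
-- Taking n ≥ (1500k + 4) r makes the lower-order terms smaller than 1/k.
module Submission where

open import Data.Bool using (Bool; true; false; _∧_; not; if_then_else_)
open import Data.Bool.Properties using (T-≡)
open import Data.Fin using (Fin; toℕ; _≟_; fromℕ<) renaming (zero to fzero; suc to fsuc)
open import Data.Fin.Properties using (<-cmp; pigeonhole; <⇒≢; toℕ<n; toℕ-fromℕ<)
open import Data.List using (tabulate)
open import Data.List.Properties using (map-tabulate)
open import Data.Nat using (ℕ; zero; suc; _+_; _*_; _^_; _∸_; _≤_; _<_; _<ᵇ_; _/_; _%_; NonZero; z≤n; s≤s)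
open import Data.Nat.Combinatorics using (_C_; nC1≡n; nCk+nC[k+1]≡[n+1]C[k+1])
open import Data.Nat.DivMod using (m/n*n≤m; m≡m%n+[m/n]*n; m%n<n; m<n*o⇒m/o<n; m*n/n≡m; /-mono-≤)
open import Data.Nat.ListAction using () renaming (sum to sumList)
open import Data.Nat.Properties
  using ( +-*-semiring; +-assoc; +-comm; *-comm; *-assoc; *-suc; *-identityʳ; +-identityʳ; *-zeroʳ
        ; *-distribˡ-+; ≤-refl; ≤-trans; ≤-reflexive; <-≤-trans; <⇒≤; <⇒<ᵇ; n<1+n; n≤1+n; m≤m+n; m≤n+m
        ; m+[n∸m]≡n; m+n≤o⇒m≤o∸n; +-mono-≤; +-monoʳ-≤; +-monoˡ-<; *-mono-≤; *-monoˡ-≤; *-monoʳ-≤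
        ; ^-monoˡ-≤; +-cancelʳ-≤; *-cancelˡ-≤; module ≤-Reasoning )
open import Data.Nat.Solver using (module +-*-Solver)
open import Data.Product using (Σ; ∃; ∃-syntax; _×_; _,_)
open import Function using (_∘_; id)
open import Function.Bundles using (Equivalence)
open import Relation.Binary using (tri<; tri≈; tri>)
open import Relation.Binary.PropositionalEquality
open import Relation.Nullary using (Dec; does; yes; no; contradiction)
open import Relation.Nullary.Decidable using (dec-true; dec-false)

open import Defs hiding (sym)
open import Algebra.Properties.Semiring.Sum +-*-semiring
  using (sum-syntax; ∑-distrib-+; ∑-comm; *-distribʳ-sum; sum-cong-≗)
open +-*-Solver using (solve; _:=_; _:+_; _:*_; _:^_; con)

ind : Bool → ℕ
ind b = if b then 1 else 0

ΣFin≡∑ : ∀ n (f : Fin n → ℕ) → ΣFin n f ≡ ∑[ i < n ] f i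
ΣFin≡∑ n f = trans (cong sumList (map-tabulate id f)) (sum-tabulate n f)
  where
  sum-tabulate : ∀ n (f : Fin n → ℕ) → sumList (tabulate f) ≡ ∑[ i < n ] f i
  sum-tabulate zero    f = refl
  sum-tabulate (suc n) f = cong (f fzero +_) (sum-tabulate n (f ∘ fsuc))

∑-mono-≤ : ∀ {n} {f g : Fin n → ℕ} → (∀ i → f i ≤ g i) → ∑[ i < n ] f i ≤ ∑[ i < n ] g i
∑-mono-≤ {zero}  f≤g = z≤n
∑-mono-≤ {suc n} f≤g = +-mono-≤ (f≤g fzero) (∑-mono-≤ (f≤g ∘ fsuc))

∑-const : ∀ n m → ∑[ i < n ] m ≡ n * m
∑-const zero    m = refl
∑-const (suc n) m = cong (m +_) (∑-const n m)

*≤∑ : ∀ {n} {f : Fin n → ℕ} m → (∀ i → m ≤ f i) → n * m ≤ ∑[ i < n ] f i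
*≤∑ {n} m m≤f = ≤-trans (≤-reflexive (sym (∑-const n m))) (∑-mono-≤ m≤f)

∑-ind-≟ : ∀ {n} (a : Fin n) → ∑[ d < n ] ind (does (a ≟ d)) ≡ 1
∑-ind-≟ {suc n} fzero    = cong suc (trans (∑-const n 0) (*-zeroʳ n))
∑-ind-≟ {suc n} (fsuc a) = ∑-ind-≟ a

∑-ind-not+∑-ind : ∀ {n} (p : Fin n → Bool) → ∑[ i < n ] ind (not (p i)) + ∑[ i < n ] ind (p i) ≡ n
∑-ind-not+∑-ind {n} p = begin
  ∑[ i < n ] ind (not (p i)) + ∑[ i < n ] ind (p i) ≡⟨ sym (∑-distrib-+ (ind ∘ not ∘ p) (ind ∘ p)) ⟩
  ∑[ i < n ] (ind (not (p i)) + ind (p i))         ≡⟨ sum-cong-≗ (complement ∘ p) ⟩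
  ∑[ i < n ] 1                                      ≡⟨ trans (∑-const n 1) (*-identityʳ n) ⟩
  n ∎
  where
  open ≡-Reasoning
  complement : ∀ b → ind (not b) + ind b ≡ 1
  complement true  = refl
  complement false = refl

∑₄ : ∀ {n} → (Fin n → Fin n → Fin n → Fin n → ℕ) → ℕ
∑₄ {n} f = ∑[ a < n ] ∑[ b < n ] ∑[ c < n ] ∑[ d < n ] f a b c d

∑₄-distrib-+ : ∀ {n} (f g : Fin n → Fin n → Fin n → Fin n → ℕ) →
  ∑₄ (λ a b c d → f a b c d + g a b c d) ≡ ∑₄ f + ∑₄ g
∑₄-distrib-+ {n} f g =
  trans (sum-cong-≗ λ a → trans (sum-cong-≗ λ b → trans (sum-cong-≗ λ c →
      ∑-distrib-+ (f a b c) (g a b c))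
    (∑-distrib-+ (λ c → ∑[ d < n ] f a b c d) _))
    (∑-distrib-+ (λ b → ∑[ c < n ] ∑[ d < n ] f a b c d) _))
  (∑-distrib-+ (λ a → ∑[ b < n ] ∑[ c < n ] ∑[ d < n ] f a b c d) _)

∑₄-reverse : ∀ {n} (f : Fin n → Fin n → Fin n → Fin n → ℕ) → ∑₄ (λ a b c d → f d c b a) ≡ ∑₄ f
∑₄-reverse {n} f = begin
  ∑[ a < n ] ∑[ b < n ] ∑[ c < n ] ∑[ d < n ] f d c b a
    ≡⟨ sum-cong-≗ (λ a → sum-cong-≗ (λ b → ∑-comm (λ c d → f d c b a))) ⟩
  ∑[ a < n ] ∑[ b < n ] ∑[ d < n ] ∑[ c < n ] f d c b a
    ≡⟨ sum-cong-≗ (λ a → ∑-comm (λ b d → ∑[ c < n ] f d c b a)) ⟩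
  ∑[ a < n ] ∑[ d < n ] ∑[ b < n ] ∑[ c < n ] f d c b a
    ≡⟨ ∑-comm (λ a d → ∑[ b < n ] ∑[ c < n ] f d c b a) ⟩
  ∑[ d < n ] ∑[ a < n ] ∑[ b < n ] ∑[ c < n ] f d c b a
    ≡⟨ sum-cong-≗ (λ d → sum-cong-≗ (λ a → ∑-comm (λ b c → f d c b a))) ⟩
  ∑[ d < n ] ∑[ a < n ] ∑[ c < n ] ∑[ b < n ] f d c b a
    ≡⟨ sum-cong-≗ (λ d → ∑-comm (λ a c → ∑[ b < n ] f d c b a)) ⟩
  ∑[ d < n ] ∑[ c < n ] ∑[ a < n ] ∑[ b < n ] f d c b a
    ≡⟨ sum-cong-≗ (λ d → sum-cong-≗ (λ c → ∑-comm (λ a b → f d c b a))) ⟩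
  ∑[ d < n ] ∑[ c < n ] ∑[ b < n ] ∑[ a < n ] f d c b a ∎
  where open ≡-Reasoning

ind-≤ : ∀ b {k} → (b ≡ true → 1 ≤ k) → ind b ≤ k
ind-≤ true  1≤k = 1≤k refl
ind-≤ false _   = z≤n

ind-*-≤ : ∀ b {m k} → (b ≡ true → m ≤ k) → ind b * m ≤ k
ind-*-≤ true  {m} m≤k = ≤-trans (≤-reflexive (+-identityʳ m)) (m≤k refl)
ind-*-≤ false _       = z≤n

1≤ind-≟ : ∀ {n} {x y : Fin n} → x ≡ y → 1 ≤ ind (does (x ≟ y))
1≤ind-≟ {x = x} {y} x≡y = ≤-reflexive (sym (cong ind (dec-true (x ≟ y) x≡y)))

does-true⁻¹ : ∀ {n} {x y : Fin n} → does (x ≟ y) ≡ true → x ≡ y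
does-true⁻¹ {x = x} {y} does≡true with x ≟ y | does≡true
... | yes x≡y | _ = x≡y

neq-true : ∀ {n} {x y : Fin n} → x ≢ y → neq x y ≡ true
neq-true {x = x} {y} x≢y = cong not (dec-false (x ≟ y) x≢y)

neq-true⁻¹ : ∀ {n} {x y : Fin n} → neq x y ≡ true → x ≢ y
neq-true⁻¹ {x = x} neq≡true refl rewrite dec-true (x ≟ x) refl with neq≡true
... | ()

∧-true⁻¹ : ∀ x {y} → x ∧ y ≡ true → x ≡ true × y ≡ true
∧-true⁻¹ true y≡true = refl , y≡true

module Paths {n : ℕ} (G : Graph n) where

  _~_ : Fin n → Fin n → Set
  x ~ y = adj G x y ≡ true

  ~-sym : ∀ {x y} → x ~ y → y ~ x
  ~-sym {x} {y} x~y = trans (Graph.sym G y x) x~y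

  ~⇒≢ : ∀ {x y} → x ~ y → x ≢ y
  ~⇒≢ {x} x~x refl with trans (sym x~x) (irrefl G x)
  ... | ()

  degree : Fin n → ℕ
  degree v = ∑[ d < n ] ind (adj G v d)

  isP3-path : ∀ {a b c d} → a ~ b → b ~ c → c ~ d → a ≢ c → a ≢ d → b ≢ d →
    toℕ a < toℕ d → isP3 G a b c d ≡ true
  isP3-path a~b b~c c~d a≢c a≢d b≢d a<d
    rewrite neq-true (~⇒≢ a~b) | neq-true a≢c | neq-true a≢d
          | neq-true (~⇒≢ b~c) | neq-true b≢d | neq-true (~⇒≢ c~d)
          | a~b | b~c | c~d | Equivalence.to T-≡ (<⇒<ᵇ a<d) = refl

  -- isP3 only accepts the orientation with a < d, so both directions are tested.
  copiesAlong : Fin n → Fin n → Fin n → Fin n → ℕ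
  copiesAlong a b c d = ind (isP3 G a b c d) + ind (isP3 G d c b a)

  copiesAlong-path : ∀ {a b c d} → a ~ b → b ~ c → c ~ d → a ≢ c → a ≢ d → b ≢ d →
    1 ≤ copiesAlong a b c d
  copiesAlong-path {a} {b} {c} {d} a~b b~c c~d a≢c a≢d b≢d with <-cmp a d
  ... | tri< a<d _ _ rewrite isP3-path a~b b~c c~d a≢c a≢d b≢d a<d = s≤s z≤n
  ... | tri≈ _ a≡d _ = contradiction a≡d a≢d
  ... | tri> _ _ d<a
    rewrite isP3-path (~-sym c~d) (~-sym b~c) (~-sym a~b) (b≢d ∘ sym) (a≢d ∘ sym) (a≢c ∘ sym) d<a =
      m≤n+m 1 _

  copiesAlong-extend : ∀ {a b c} → a ~ b → b ~ c → a ≢ c → ∀ d →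
    ind (adj G c d) ≤ copiesAlong a b c d + (ind (does (a ≟ d)) + ind (does (b ≟ d)))
  copiesAlong-extend {a} {b} {c} a~b b~c a≢c d = ind-≤ (adj G c d) λ c~d → cases c~d (a ≟ d) (b ≟ d)
    where
    [a≡d] [b≡d] : ℕ
    [a≡d] = ind (does (a ≟ d))
    [b≡d] = ind (does (b ≟ d))
    cases : c ~ d → Dec (a ≡ d) → Dec (b ≡ d) → 1 ≤ copiesAlong a b c d + ([a≡d] + [b≡d])
    cases _   (yes a≡d) _         = ≤-trans (1≤ind-≟ a≡d) (≤-trans (m≤m+n _ [b≡d]) (m≤n+m _ (copiesAlong a b c d)))
    cases _   (no _)    (yes b≡d) = ≤-trans (1≤ind-≟ b≡d) (≤-trans (m≤n+m _ [a≡d]) (m≤n+m _ (copiesAlong a b c d)))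
    cases c~d (no a≢d)  (no b≢d)  = ≤-trans (copiesAlong-path a~b b~c c~d a≢c a≢d b≢d) (m≤m+n _ _)

  module _ (e : ℕ) (minDegree : ∀ v → e + 2 ≤ degree v) where

    copiesAlong-from-abc : ∀ {a b c} → a ~ b → b ~ c → a ≢ c → e ≤ ∑[ d < n ] copiesAlong a b c d
    copiesAlong-from-abc {a} {b} {c} a~b b~c a≢c = +-cancelʳ-≤ 2 e _ (begin
      e + 2                                    ≤⟨ minDegree c ⟩
      degree c                                 ≤⟨ ∑-mono-≤ (copiesAlong-extend a~b b~c a≢c) ⟩
      ∑[ d < n ] (copiesAlong a b c d + (ind (does (a ≟ d)) + ind (does (b ≟ d))))
        ≡⟨ ∑-distrib-+ (copiesAlong a b c) _ ⟩
      ∑[ d < n ] copiesAlong a b c d + ∑[ d < n ] (ind (does (a ≟ d)) + ind (does (b ≟ d)))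
        ≡⟨ cong (∑[ d < n ] copiesAlong a b c d +_)
             (trans (∑-distrib-+ (λ d → ind (does (a ≟ d))) _) (cong₂ _+_ (∑-ind-≟ a) (∑-ind-≟ b))) ⟩
      ∑[ d < n ] copiesAlong a b c d + 2       ∎)
      where open ≤-Reasoning

    choices-of-c : ∀ a b → e + 1 ≤ ∑[ c < n ] ind (adj G b c ∧ neq a c)
    choices-of-c a b = +-cancelʳ-≤ 1 (e + 1) _ (begin
      e + 1 + 1                                                       ≡⟨ +-assoc e 1 1 ⟩
      e + 2                                                           ≤⟨ minDegree b ⟩
      degree b                                                        ≤⟨ ∑-mono-≤ avoid-a ⟩
      ∑[ c < n ] (ind (adj G b c ∧ neq a c) + ind (does (a ≟ c)))     ≡⟨ ∑-distrib-+ (λ c → ind (adj G b c ∧ neq a c)) (λ c → ind (does (a ≟ c))) ⟩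
      ∑[ c < n ] ind (adj G b c ∧ neq a c) + ∑[ c < n ] ind (does (a ≟ c)) ≡⟨ cong (∑[ c < n ] ind (adj G b c ∧ neq a c) +_) (∑-ind-≟ a) ⟩
      ∑[ c < n ] ind (adj G b c ∧ neq a c) + 1                        ∎)
      where
      open ≤-Reasoning
      avoid-a : ∀ c → ind (adj G b c) ≤ ind (adj G b c ∧ neq a c) + ind (does (a ≟ c))
      avoid-a c with adj G b c | a ≟ c
      ... | false | _     = z≤n
      ... | true  | yes _ = s≤s z≤n
      ... | true  | no _  = s≤s z≤n

    copiesAlong-from-ab : ∀ {a b} → a ~ b → (e + 1) * e ≤ ∑[ c < n ] ∑[ d < n ] copiesAlong a b c d
    copiesAlong-from-ab {a} {b} a~b = begin
      (e + 1) * e                                       ≤⟨ *-monoˡ-≤ e (choices-of-c a b) ⟩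
      ∑[ c < n ] ind (adj G b c ∧ neq a c) * e         ≡⟨ *-distribʳ-sum e (λ c → ind (adj G b c ∧ neq a c)) ⟩
      ∑[ c < n ] (ind (adj G b c ∧ neq a c) * e)       ≤⟨ ∑-mono-≤ extend ⟩
      ∑[ c < n ] ∑[ d < n ] copiesAlong a b c d         ∎
      where
      open ≤-Reasoning
      extend : ∀ c → ind (adj G b c ∧ neq a c) * e ≤ ∑[ d < n ] copiesAlong a b c d
      extend c = ind-*-≤ (adj G b c ∧ neq a c) λ h →
        let b~c , a≠c = ∧-true⁻¹ (adj G b c) h in copiesAlong-from-abc a~b b~c (neq-true⁻¹ a≠c)

    copiesAlong-from-a : ∀ a → (e + 2) * ((e + 1) * e) ≤ ∑[ b < n ] ∑[ c < n ] ∑[ d < n ] copiesAlong a b c d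
    copiesAlong-from-a a = begin
      (e + 2) * ((e + 1) * e)                            ≤⟨ *-monoˡ-≤ _ (minDegree a) ⟩
      degree a * ((e + 1) * e)                           ≡⟨ *-distribʳ-sum _ (ind ∘ adj G a) ⟩
      ∑[ b < n ] (ind (adj G a b) * ((e + 1) * e))      ≤⟨ ∑-mono-≤ (λ b → ind-*-≤ (adj G a b) copiesAlong-from-ab) ⟩
      ∑[ b < n ] ∑[ c < n ] ∑[ d < n ] copiesAlong a b c d ∎
      where open ≤-Reasoning

    ∑₄-copiesAlong-minDegree : n * ((e + 2) * ((e + 1) * e)) ≤ ∑₄ copiesAlong
    ∑₄-copiesAlong-minDegree = *≤∑ _ copiesAlong-from-a

  νP3≡∑₄ : νP3 G ≡ ∑₄ λ a b c d → ind (isP3 G a b c d)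
  νP3≡∑₄ =
    trans (ΣFin≡∑ n λ a → ΣFin n λ b → ΣFin n λ c → countFin n (isP3 G a b c)) (sum-cong-≗ λ a →
    trans (ΣFin≡∑ n λ b → ΣFin n λ c → countFin n (isP3 G a b c)) (sum-cong-≗ λ b →
    trans (ΣFin≡∑ n λ c → countFin n (isP3 G a b c)) (sum-cong-≗ λ c →
    ΣFin≡∑ n (ind ∘ isP3 G a b c))))

  ∑₄-copiesAlong : ∑₄ copiesAlong ≡ νP3 G + νP3 G
  ∑₄-copiesAlong = begin
    ∑₄ copiesAlong                            ≡⟨ ∑₄-distrib-+ isP3₄ (λ a b c d → isP3₄ d c b a) ⟩
    ∑₄ isP3₄ + ∑₄ (λ a b c d → isP3₄ d c b a)  ≡⟨ cong (∑₄ isP3₄ +_) (∑₄-reverse isP3₄) ⟩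
    ∑₄ isP3₄ + ∑₄ isP3₄                        ≡⟨ cong₂ _+_ (sym νP3≡∑₄) (sym νP3≡∑₄) ⟩
    νP3 G + νP3 G                              ∎
    where
    open ≡-Reasoning
    isP3₄ : Fin n → Fin n → Fin n → Fin n → ℕ
    isP3₄ a b c d = ind (isP3 G a b c d)

  νP3-minDegree : ∀ e → (∀ v → e + 2 ≤ degree v) → n * ((e + 2) * ((e + 1) * e)) ≤ νP3 G + νP3 G
  νP3-minDegree e minDegree = ≤-trans (∑₄-copiesAlong-minDegree e minDegree) (≤-reflexive ∑₄-copiesAlong)

neq-sym : ∀ {n} (x y : Fin n) → neq x y ≡ neq y x
neq-sym x y with x ≟ y | y ≟ x
... | yes _   | yes _   = refl
... | no _    | no _    = refl
... | yes x≡y | no y≢x  = contradiction (sym x≡y) y≢x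
... | no x≢y  | yes y≡x = contradiction (sym y≡x) x≢y

neq-irrefl : ∀ {n} (x : Fin n) → neq x x ≡ false
neq-irrefl x = cong not (dec-true (x ≟ x) refl)

completeMultipartite : ∀ {n r} → (Fin n → Fin r) → Graph n
completeMultipartite colour = record
  { adj    = λ i j → neq (colour i) (colour j)
  ; sym    = λ i j → neq-sym (colour i) (colour j)
  ; irrefl = λ i → neq-irrefl (colour i)
  }

completeMultipartite-KFree : ∀ {n r} (colour : Fin n → Fin r) → KFree r (completeMultipartite colour)
completeMultipartite-KFree {r = r} colour (f , _ , clique)
  with pigeonhole (n<1+n r) (colour ∘ f)
... | i , j , i<j , same-colour = neq-true⁻¹ (clique i j (<⇒≢ i<j)) same-colour

colourClass : ∀ {n r} → (Fin n → Fin r) → Fin n → ℕ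
colourClass {n} colour v = ∑[ d < n ] ind (does (colour v ≟ colour d))

completeMultipartite-degree : ∀ {n r} (colour : Fin n → Fin r) v →
  Paths.degree (completeMultipartite colour) v + colourClass colour v ≡ n
completeMultipartite-degree colour v = ∑-ind-not+∑-ind (λ d → does (colour v ≟ colour d))

-- lo ≤ m < lo + s, phrased with <ᵇ so that shifting lo and m by one is definitional.
inInterval : ℕ → ℕ → ℕ → Bool
inInterval lo s m = (lo <ᵇ suc m) ∧ (m <ᵇ lo + s)

∑-inInterval : ∀ n lo s → ∑[ d < n ] ind (inInterval lo s (toℕ d)) ≤ s
∑-inInterval zero    lo       s       = z≤n
∑-inInterval (suc n) (suc lo) s       = ∑-inInterval n lo s
∑-inInterval (suc n) zero     zero    = ∑-inInterval n zero zero
∑-inInterval (suc n) zero     (suc s) = s≤s (∑-inInterval n zero s)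

m<[m/n]*n+n : ∀ m n .{{_ : NonZero n}} → m < m / n * n + n
m<[m/n]*n+n m n = begin-strict
  m                  ≡⟨ m≡m%n+[m/n]*n m n ⟩
  m % n + m / n * n  <⟨ +-monoˡ-< _ (m%n<n m n) ⟩
  n + m / n * n      ≡⟨ +-comm n _ ⟩
  m / n * n + n      ∎
  where open ≤-Reasoning

inInterval-/ : ∀ m s .{{_ : NonZero s}} → inInterval (m / s * s) s m ≡ true
inInterval-/ m s
  rewrite Equivalence.to T-≡ (<⇒<ᵇ (s≤s (m/n*n≤m m s)))
        | Equivalence.to T-≡ (<⇒<ᵇ (m<[m/n]*n+n m s)) = refl

blocks : ∀ {n} r s .{{_ : NonZero s}} → n ≤ r * s → Fin n → Fin r
blocks r s n≤rs d = fromℕ< (m<n*o⇒m/o<n (<-≤-trans (toℕ<n d) n≤rs))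

blocks-colourClass : ∀ {n} r s .{{_ : NonZero s}} (n≤rs : n ≤ r * s) v → colourClass (blocks r s n≤rs) v ≤ s
blocks-colourClass {n} r s n≤rs v = ≤-trans (∑-mono-≤ same-block⇒interval) (∑-inInterval n (toℕ v / s * s) s)
  where
  same-block⇒interval : ∀ d → ind (does (blocks r s n≤rs v ≟ blocks r s n≤rs d)) ≤ ind (inInterval (toℕ v / s * s) s (toℕ d))
  same-block⇒interval d = ind-≤ _ λ same → ≤-reflexive (sym (cong ind (
    trans (cong (λ q → inInterval (q * s) s (toℕ d)) (same-quotient same)) (inInterval-/ (toℕ d) s))))
    where
    same-quotient : does (blocks r s n≤rs v ≟ blocks r s n≤rs d) ≡ true → toℕ v / s ≡ toℕ d / s
    same-quotient same = trans (sym (toℕ-fromℕ< _))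
      (trans (cong toℕ (does-true⁻¹ same)) (toℕ-fromℕ< _))

n<r*[1+n/r] : ∀ n r .{{_ : NonZero r}} → n < r * suc (n / r)
n<r*[1+n/r] n r = <-≤-trans (m<[m/n]*n+n n r)
  (≤-reflexive (trans (+-comm (n / r * r) r) (trans (cong (r +_) (*-comm (n / r) r)) (sym (*-suc r (n / r))))))

-- Consecutive blocks of ⌊n/r⌋ + 1 vertices; the last parts may be shorter or empty.
blockColouring : ∀ n r .{{_ : NonZero r}} → Fin n → Fin r
blockColouring n r = blocks r (suc (n / r)) (<⇒≤ (n<r*[1+n/r] n r))

blockGraph : ∀ n r .{{_ : NonZero r}} → Graph n
blockGraph n r = completeMultipartite (blockColouring n r)

blockGraph-degree : ∀ n r .{{_ : NonZero r}} v → n ≤ Paths.degree (blockGraph n r) v + suc (n / r)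
blockGraph-degree n r v = begin
  n                                                                 ≡⟨ sym (completeMultipartite-degree (blockColouring n r) v) ⟩
  Paths.degree (blockGraph n r) v + colourClass (blockColouring n r) v ≤⟨ +-monoʳ-≤ _ (blocks-colourClass r (suc (n / r)) (<⇒≤ (n<r*[1+n/r] n r)) v) ⟩
  Paths.degree (blockGraph n r) v + suc (n / r)                     ∎
  where open ≤-Reasoning

2*C2 : ∀ m → 2 * (suc m C 2) ≡ suc m * m
2*C2 zero    = refl
2*C2 (suc m) = begin
  2 * (suc (suc m) C 2)              ≡⟨ cong (2 *_) (sym (nCk+nC[k+1]≡[n+1]C[k+1] (suc m) 1)) ⟩
  2 * (suc m C 1 + suc m C 2)        ≡⟨ *-distribˡ-+ 2 (suc m C 1) _ ⟩
  2 * (suc m C 1) + 2 * (suc m C 2)  ≡⟨ cong₂ (λ x y → 2 * x + y) (nC1≡n (suc m)) (2*C2 m) ⟩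
  2 * suc m + suc m * m              ≡⟨ solve 1 (λ m → con 2 :* (con 1 :+ m) :+ (con 1 :+ m) :* m := (con 2 :+ m) :* (con 1 :+ m)) refl m ⟩
  suc (suc m) * suc m                ∎
  where open ≡-Reasoning

6*C3 : ∀ m → 6 * ((2 + m) C 3) ≡ (2 + m) * ((1 + m) * m)
6*C3 zero    = refl
6*C3 (suc m) = begin
  6 * ((3 + m) C 3)                         ≡⟨ cong (6 *_) (sym (nCk+nC[k+1]≡[n+1]C[k+1] (2 + m) 2)) ⟩
  6 * ((2 + m) C 2 + (2 + m) C 3)             ≡⟨ *-distribˡ-+ 6 ((2 + m) C 2) _ ⟩
  6 * ((2 + m) C 2) + 6 * ((2 + m) C 3)       ≡⟨ cong (_+ 6 * ((2 + m) C 3)) (*-assoc 3 2 ((2 + m) C 2)) ⟩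
  3 * (2 * ((2 + m) C 2)) + 6 * ((2 + m) C 3) ≡⟨ cong₂ (λ x y → 3 * x + y) (2*C2 (suc m)) (6*C3 m) ⟩
  3 * ((2 + m) * (1 + m)) + (2 + m) * ((1 + m) * m)
    ≡⟨ solve 1 (λ m → con 3 :* ((con 2 :+ m) :* (con 1 :+ m)) :+ (con 2 :+ m) :* ((con 1 :+ m) :* m)
                   := (con 3 :+ m) :* ((con 2 :+ m) :* (con 1 :+ m))) refl m ⟩
  (3 + m) * ((2 + m) * (1 + m))           ∎
  where open ≡-Reasoning

24*C4 : ∀ m → 24 * ((3 + m) C 4) ≡ (3 + m) * ((2 + m) * ((1 + m) * m))
24*C4 zero    = refl
24*C4 (suc m) = begin
  24 * ((4 + m) C 4)                         ≡⟨ cong (24 *_) (sym (nCk+nC[k+1]≡[n+1]C[k+1] (3 + m) 3)) ⟩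
  24 * ((3 + m) C 3 + (3 + m) C 4)             ≡⟨ *-distribˡ-+ 24 ((3 + m) C 3) _ ⟩
  24 * ((3 + m) C 3) + 24 * ((3 + m) C 4)     ≡⟨ cong (_+ 24 * ((3 + m) C 4)) (*-assoc 4 6 ((3 + m) C 3)) ⟩
  4 * (6 * ((3 + m) C 3)) + 24 * ((3 + m) C 4) ≡⟨ cong₂ (λ x y → 4 * x + y) (6*C3 (suc m)) (24*C4 m) ⟩
  4 * ((3 + m) * ((2 + m) * (1 + m))) + (3 + m) * ((2 + m) * ((1 + m) * m))
    ≡⟨ solve 1 (λ m → con 4 :* ((con 3 :+ m) :* ((con 2 :+ m) :* (con 1 :+ m))) :+ (con 3 :+ m) :* ((con 2 :+ m) :* ((con 1 :+ m) :* m))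
                   := (con 4 :+ m) :* ((con 3 :+ m) :* ((con 2 :+ m) :* (con 1 :+ m)))) refl m ⟩
  (4 + m) * ((3 + m) * ((2 + m) * (1 + m))) ∎
  where open ≡-Reasoning

24*C4≤^4 : ∀ n → 24 * (n C 4) ≤ n ^ 4
24*C4≤^4 0 = z≤n
24*C4≤^4 1 = z≤n
24*C4≤^4 2 = z≤n
24*C4≤^4 (suc (suc (suc m))) = begin
  24 * ((3 + m) C 4)                            ≡⟨ 24*C4 m ⟩
  (3 + m) * ((2 + m) * ((1 + m) * m))           ≤⟨ *-monoʳ-≤ (3 + m) (*-mono-≤ (n≤1+n (2 + m)) (*-mono-≤ (m≤n+m (1 + m) 2) m≤3+m*1)) ⟩
  (3 + m) ^ 4                                   ∎
  where
  open ≤-Reasoning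
  m≤3+m*1 : m ≤ (3 + m) * 1
  m≤3+m*1 = ≤-trans (m≤n+m m 3) (≤-reflexive (sym (*-identityʳ (3 + m))))

*[∸3]^3≤24*C4 : ∀ n → n * (n ∸ 3) ^ 3 ≤ 24 * (n C 4)
*[∸3]^3≤24*C4 0 = z≤n
*[∸3]^3≤24*C4 1 = z≤n
*[∸3]^3≤24*C4 2 = z≤n
*[∸3]^3≤24*C4 (suc (suc (suc m))) = begin
  (3 + m) * m ^ 3                             ≤⟨ *-monoʳ-≤ (3 + m) (*-mono-≤ (m≤n+m m 2) (*-mono-≤ (m≤n+m m 1) (≤-reflexive (*-identityʳ m)))) ⟩
  (3 + m) * ((2 + m) * ((1 + m) * m))         ≡⟨ sym (24*C4 m) ⟩
  24 * ((3 + m) C 4)                          ∎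
  where open ≤-Reasoning

-- (5 + p)³ - p³ = 15p² + 75p + 125 ≤ 125 (1 + p)², and 12 · 125 = 1500.
slack : ∀ c k p m → 1500 * k ≤ 1 + p → (1 + p) * c ≤ m →
  12 * k * c ^ 3 * (15 * p ^ 2 + 75 * p + 125) ≤ m ^ 3
slack c k p m 1500k≤1+p [1+p]c≤m = begin
  12 * k * c ^ 3 * (15 * p ^ 2 + 75 * p + 125)      ≤⟨ *-monoʳ-≤ (12 * k * c ^ 3) (m≤m+n _ (110 * p ^ 2 + 175 * p)) ⟩
  12 * k * c ^ 3 * (15 * p ^ 2 + 75 * p + 125 + (110 * p ^ 2 + 175 * p))
    ≡⟨ solve 3 (λ c k p → con 12 :* k :* c :^ 3 :* (con 15 :* p :^ 2 :+ con 75 :* p :+ con 125 :+ (con 110 :* p :^ 2 :+ con 175 :* p))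
                       := con 1500 :* k :* c :^ 3 :* (con 1 :+ p) :^ 2) refl c k p ⟩
  1500 * k * c ^ 3 * (1 + p) ^ 2                    ≤⟨ *-monoˡ-≤ ((1 + p) ^ 2) (*-monoˡ-≤ (c ^ 3) 1500k≤1+p) ⟩
  (1 + p) * c ^ 3 * (1 + p) ^ 2
    ≡⟨ solve 2 (λ c p → (con 1 :+ p) :* c :^ 3 :* (con 1 :+ p) :^ 2 := ((con 1 :+ p) :* c) :^ 3) refl c p ⟩
  ((1 + p) * c) ^ 3                                 ≤⟨ ^-monoˡ-≤ 3 [1+p]c≤m ⟩
  m ^ 3                                             ∎
  where open ≤-Reasoning

cubic-bound : ∀ c k p m n → 1500 * k ≤ 1 + p → (1 + p) * c ≤ m → n ≤ (5 + p) * suc c →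
  12 * c ^ 3 * k * n ^ 3 ≤ 12 * suc c ^ 3 * k * (p * c) ^ 3 + suc c ^ 3 * m ^ 3
cubic-bound c k p m n 1500k≤1+p [1+p]c≤m n≤[5+p][1+c] = begin
  12 * c ^ 3 * k * n ^ 3                        ≤⟨ *-monoʳ-≤ (12 * c ^ 3 * k) (^-monoˡ-≤ 3 n≤[5+p][1+c]) ⟩
  12 * c ^ 3 * k * ((5 + p) * suc c) ^ 3
    ≡⟨ solve 3 (λ c k p → con 12 :* c :^ 3 :* k :* ((con 5 :+ p) :* (con 1 :+ c)) :^ 3
                       := con 12 :* (con 1 :+ c) :^ 3 :* k :* (p :* c) :^ 3
                          :+ (con 1 :+ c) :^ 3 :* (con 12 :* k :* c :^ 3 :* (con 15 :* p :^ 2 :+ con 75 :* p :+ con 125)))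
             refl c k p ⟩
  12 * suc c ^ 3 * k * (p * c) ^ 3 + suc c ^ 3 * (12 * k * c ^ 3 * (15 * p ^ 2 + 75 * p + 125))
    ≤⟨ +-monoʳ-≤ (12 * suc c ^ 3 * k * (p * c) ^ 3) (*-monoʳ-≤ (suc c ^ 3) (slack c k p m 1500k≤1+p [1+p]c≤m)) ⟩
  12 * suc c ^ 3 * k * (p * c) ^ 3 + suc c ^ 3 * m ^ 3 ∎
  where open ≤-Reasoning

density-arithmetic : ∀ c k p n ν → 1500 * k ≤ 1 + p → (4 + p) * suc c ≤ n → n ≤ (5 + p) * suc c →
  n * (p * c) ^ 3 ≤ ν + ν → 12 * c ^ 3 * k * (n C 4) ≤ ν * suc c ^ 3 * k + suc c ^ 3 * (n C 4)
density-arithmetic c k p n ν 1500k≤1+p [4+p][1+c]≤n n≤[5+p][1+c] paths = *-cancelˡ-≤ 24 (begin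
  24 * (12 * c ^ 3 * k * (n C 4))
    ≡⟨ solve 3 (λ c k C → con 24 :* (con 12 :* c :^ 3 :* k :* C) := con 12 :* c :^ 3 :* k :* (con 24 :* C)) refl c k (n C 4) ⟩
  12 * c ^ 3 * k * (24 * (n C 4))               ≤⟨ *-monoʳ-≤ (12 * c ^ 3 * k) (24*C4≤^4 n) ⟩
  12 * c ^ 3 * k * n ^ 4
    ≡⟨ solve 3 (λ c k n → con 12 :* c :^ 3 :* k :* n :^ 4 := n :* (con 12 :* c :^ 3 :* k :* n :^ 3)) refl c k n ⟩
  n * (12 * c ^ 3 * k * n ^ 3)
    ≤⟨ *-monoʳ-≤ n (cubic-bound c k p (n ∸ 3) n 1500k≤1+p [1+p]c≤n∸3 n≤[5+p][1+c]) ⟩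
  n * (12 * suc c ^ 3 * k * (p * c) ^ 3 + suc c ^ 3 * (n ∸ 3) ^ 3)
    ≡⟨ solve 5 (λ R k P M n → n :* (con 12 :* R :* k :* P :+ R :* M) := con 12 :* R :* k :* (n :* P) :+ R :* (n :* M))
             refl (suc c ^ 3) k ((p * c) ^ 3) ((n ∸ 3) ^ 3) n ⟩
  12 * suc c ^ 3 * k * (n * (p * c) ^ 3) + suc c ^ 3 * (n * (n ∸ 3) ^ 3)
    ≤⟨ +-mono-≤ (*-monoʳ-≤ (12 * suc c ^ 3 * k) paths) (*-monoʳ-≤ (suc c ^ 3) (*[∸3]^3≤24*C4 n)) ⟩
  12 * suc c ^ 3 * k * (ν + ν) + suc c ^ 3 * (24 * (n C 4))
    ≡⟨ solve 4 (λ R k ν C → con 12 :* R :* k :* (ν :+ ν) :+ R :* (con 24 :* C) := con 24 :* (ν :* R :* k :+ R :* C))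
             refl (suc c ^ 3) k ν (n C 4) ⟩
  24 * (ν * suc c ^ 3 * k + suc c ^ 3 * (n C 4)) ∎)
  where
  open ≤-Reasoning
  [1+p]c≤n∸3 : (1 + p) * c ≤ n ∸ 3
  [1+p]c≤n∸3 = m+n≤o⇒m≤o∸n ((1 + p) * c) (≤-trans (m≤m+n ((1 + p) * c + 3) (3 * c + 1 + p))
    (≤-trans (≤-reflexive (solve 2 (λ c p → (con 1 :+ p) :* c :+ con 3 :+ (con 3 :* c :+ con 1 :+ p) := (con 4 :+ p) :* (con 1 :+ c)) refl c p))
      [4+p][1+c]≤n))

large-quotient : ∀ k n r .{{_ : NonZero r}} → (1500 * k + 4) * r ≤ n →
  ∃[ p ] n / r ≡ 4 + p × 1500 * k ≤ 1 + p
large-quotient k n r N≤n = n / r ∸ 4 , sym (m+[n∸m]≡n 4≤q) , ≤-trans (m+n≤o⇒m≤o∸n (1500 * k) N≤q) (n≤1+n _)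
  where
  N≤q : 1500 * k + 4 ≤ n / r
  N≤q = ≤-trans (≤-reflexive (sym (m*n/n≡m (1500 * k + 4) r))) (/-mono-≤ N≤n ≤-refl)
  4≤q : 4 ≤ n / r
  4≤q = ≤-trans (m≤n+m 4 (1500 * k)) N≤q

quotient-bounds : ∀ n r {q} .{{_ : NonZero r}} → n / r ≡ q → q * r ≤ n × n ≤ suc q * r
quotient-bounds n r refl = m/n*n≤m n r , ≤-trans (<⇒≤ (n<r*[1+n/r] n r)) (≤-reflexive (*-comm r (suc (n / r))))

^3≤[+3][+2][+1] : ∀ x → x ^ 3 ≤ (x + 1 + 2) * ((x + 1 + 1) * (x + 1))
^3≤[+3][+2][+1] x = *-mono-≤ (≤-trans (m≤m+n x 1) (m≤m+n (x + 1) 2))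
  (*-mono-≤ (≤-trans (m≤m+n x 1) (m≤m+n (x + 1) 1)) (≤-trans (≤-reflexive (*-identityʳ x)) (m≤m+n x 1)))

blockGraph-νP3 : ∀ c n p → 1 ≤ c → (4 + p) * suc c ≤ n → n / suc c ≡ 4 + p →
  n * (p * c) ^ 3 ≤ νP3 (blockGraph n (suc c)) + νP3 (blockGraph n (suc c))
blockGraph-νP3 c@(suc c′) n p _ [4+p][1+c]≤n q≡4+p =
  ≤-trans (*-monoʳ-≤ n (^3≤[+3][+2][+1] (p * c))) (Paths.νP3-minDegree (blockGraph n (suc c)) (p * c + 1) minDegree)
  where
  minDegree : ∀ v → p * c + 1 + 2 ≤ Paths.degree (blockGraph n (suc c)) v
  minDegree v = +-cancelʳ-≤ (5 + p) (p * c + 1 + 2) _ (begin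
    p * c + 1 + 2 + (5 + p)                    ≤⟨ m≤m+n _ (4 * c′) ⟩
    p * c + 1 + 2 + (5 + p) + 4 * c′
      ≡⟨ solve 2 (λ c′ p → p :* (con 1 :+ c′) :+ con 1 :+ con 2 :+ (con 5 :+ p) :+ con 4 :* c′ := (con 4 :+ p) :* (con 2 :+ c′)) refl c′ p ⟩
    (4 + p) * suc c                            ≤⟨ [4+p][1+c]≤n ⟩
    n                                          ≤⟨ blockGraph-degree n (suc c) v ⟩
    Paths.degree (blockGraph n (suc c)) v + suc (n / suc c) ≡⟨ cong (λ q → Paths.degree (blockGraph n (suc c)) v + suc q) q≡4+p ⟩
    Paths.degree (blockGraph n (suc c)) v + (5 + p) ∎)
    where open ≤-Reasoning

lemma2p1 : ∀ (r : ℕ) → 3 ≤ r → ∀ (k : ℕ) → 1 ≤ k →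
    ∃[ N ] (∀ (n : ℕ) → N ≤ n →
      Σ (Graph n) λ G → KFree r G × DensityBound r k G)
lemma2p1 r@(suc c) (s≤s 2≤c) k _ = (1500 * k + 4) * r , λ n N≤n →
  blockGraph n r , completeMultipartite-KFree (blockColouring n r) , densityBound n N≤n
  where
  densityBound : ∀ n → (1500 * k + 4) * r ≤ n → DensityBound r k (blockGraph n r)
  densityBound n N≤n with large-quotient k n r N≤n
  ... | p , q≡4+p , 1500k≤1+p with quotient-bounds n r q≡4+p
  ... | lower , upper = density-arithmetic c k p n (νP3 (blockGraph n r)) 1500k≤1+p lower upper
    (blockGraph-νP3 c n p (≤-trans (s≤s z≤n) 2≤c) lower q≡4+p)
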